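{- Consider the game "Corner the Queen Bee" described in the context, and let $(a_n,b_n)$, $n\ge 1$, be its $P$-positions other than $(0,0)$ with $a_n\le b_n$, listed in increasing order of the first coordinate. Then $b_n=2a_n$ for every $n\ge 1$, and every positive integer occurs exactly once among the numbers $a_1,b_1,a_2,b_2,\ldots$.
   Context: Positions are pairs $(x,y)$ of nonnegative integers (squares of an infinite quarter-plane chess board). From $(x,y)$ the Queen Bee may move to: (i) $(x',y)$ with $0\le x'<x$, or $(x,y')$ with $0\le y'<y$; (ii) $(x-s,y-s)$ with $1\le s\le\min(x,y)$ (diagonal move); (iii) bouncing moves: if $x<y$, to $(t,y-x)$ with $0<t<2x$; if $x>y$, to $(x-y,t)$ with $0<t<2y$ (she travels diagonally to the side of the board and then continues perpendicular to that side, as long as the Manhattan distance $x+y$ strictly decreases). Every move strictly decreases $x+y$. Two players alternate moves; the player who moves the Queen to $(0,0)$ wins (normal play). $P$-positions are defined recursively: $(0,0)$ is a $P$-position, and a position is a $P$-position iff it has no move to a $P$-position. The set of $P$-positions is symmetric under $(x,y)\mapsto(y,x)$. -}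

module Defs where

open import Data.Nat using (ℕ; zero; suc; _+_; _*_; _∸_; _≤_; _<_)

data Move (x y : ℕ) : ℕ → ℕ → Set where
  left    : ∀ {x'} → x' < x → Move x y x' y
  down    : ∀ {y'} → y' < y → Move x y x y'
  diag    : ∀ {s} → 1 ≤ s → s ≤ x → s ≤ y → Move x y (x ∸ s) (y ∸ s)
  bounceL : ∀ {t} → x < y → 0 < t → t < 2 * x → Move x y t (y ∸ x)
  bounceD : ∀ {t} → y < x → 0 < t → t < 2 * y → Move x y (x ∸ y) t

-- P-positions (IsP) and N-positions (IsN), defined by mutual induction
-- (well-founded since every move strictly decreases x + y):
-- a position is P iff every move leads to an N-position, i.e. it has no
-- move to a P-position; a position is N iff it has a move to a P-position.
-- (0 , 0) has no moves, hence is P.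
data IsP (x y : ℕ) : Set
data IsN (x y : ℕ) : Set

data IsP x y where
  p-pos : (∀ {x' y'} → Move x y x' y' → IsN x' y') → IsP x y

data IsN x y where
  n-pos : ∀ {x' y'} → Move x y x' y' → IsP x' y' → IsN x y

{-# OPTIONS --safe #-}
-- The P-positions other than (0 , 0) are (a , 2a) and (2a , a), where the 2-adic
-- valuation of a is even. Every positive integer then lies in exactly one of them:
-- m itself if its valuation is even, and m / 2 otherwise. That this set K is the set
-- of P-positions follows from K being a kernel of the game graph: no move joins two
-- positions of K (K meets each row in a single square, and a diagonal move keeps
-- y - x, whereas on K the difference equals the smaller coordinate), and from every
-- position outside K some move enters K (a rook move towards the partner of the
-- smaller coordinate, or a diagonal or bouncing move guided by the difference y - x).
module Submission where

open import Defs
open import Data.Nat using (ℕ; zero; suc; _+_; _*_; _∸_; _≤_; _<_; z≤n; s≤s; z<s; _≤?_)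
open import Data.Nat.Properties
open import Data.Nat.DivMod using (_%_; m*n%n≡0; [m+kn]%n≡m%n)
open import Data.Nat.Induction using (<-wellFounded)
open import Induction.WellFounded using (Acc; acc)
open import Data.Product using (Σ; ∃-syntax; ∃₂; _×_; _,_; proj₁; proj₂)
open import Data.Sum using (_⊎_; inj₁; inj₂)
open import Data.Empty using (⊥-elim)
open import Function.Bundles using (_⇔_; mk⇔; Equivalence)
open import Relation.Binary.PropositionalEquality
  using (_≡_; _≢_; refl; sym; trans; cong; subst; subst₂; module ≡-Reasoning)
open import Relation.Nullary using (¬_; yes; no)

open Equivalence using (to; from)

n<2*n : ∀ {n} → 0 < n → n < 2 * n
n<2*n {suc n} _ = s≤s (m<m+n n z<s)

2*n≡n+n : ∀ n → 2 * n ≡ n + n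
2*n≡n+n n = cong (n +_) (+-identityʳ n)

2*n∸n≡n : ∀ n → 2 * n ∸ n ≡ n
2*n∸n≡n n = trans (cong (_∸ n) (2*n≡n+n n)) (m+n∸m≡n n n)

2*m≢1+2*n : ∀ m n → 2 * m ≢ 1 + 2 * n
2*m≢1+2*n m n eq = 0≢1+n {0} (begin
  0                 ≡⟨ sym (m*n%n≡0 m 2) ⟩
  (m * 2) % 2       ≡⟨ cong (_% 2) (trans (*-comm m 2) eq) ⟩
  (1 + 2 * n) % 2   ≡⟨ cong (_% 2) (cong (1 +_) (*-comm 2 n)) ⟩
  (1 + n * 2) % 2   ≡⟨ [m+kn]%n≡m%n 1 n 2 ⟩
  1                 ∎)
  where open ≡-Reasoning

parity : ∀ n → ∃[ k ] (n ≡ 2 * k ⊎ n ≡ 1 + 2 * k)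
parity zero = 0 , inj₁ refl
parity (suc n) with parity n
... | k , inj₁ n≡2k   = k , inj₂ (cong suc n≡2k)
... | k , inj₂ n≡1+2k = suc k , inj₁ (trans (cong suc n≡1+2k) (sym (*-suc 2 k)))

data EvenValuation : ℕ → Set
data OddValuation : ℕ → Set

data EvenValuation where
  odd    : ∀ {n} k → n ≡ 1 + 2 * k → EvenValuation n
  double : ∀ {n c} → OddValuation c → n ≡ 2 * c → EvenValuation n

data OddValuation where
  double : ∀ {n c} → EvenValuation c → n ≡ 2 * c → OddValuation n

evenValuation-positive : ∀ {n} → EvenValuation n → 0 < n
oddValuation-positive : ∀ {n} → OddValuation n → 0 < n
evenValuation-positive (odd k refl) = z<s
evenValuation-positive (double {c = c} oc refl) = ≤-trans (oddValuation-positive oc) (m≤n*m c 2)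
oddValuation-positive (double {c = c} ec refl) = ≤-trans (evenValuation-positive ec) (m≤n*m c 2)

valuation-exclusive : ∀ {n} → EvenValuation n → ¬ OddValuation n
valuation-exclusive (odd k n≡1+2k) (double {c = c} _ n≡2c) = 2*m≢1+2*n c k (trans (sym n≡2c) n≡1+2k)
valuation-exclusive (double {c = c} oc n≡2c) (double {c = c'} ec n≡2c')
  with *-cancelˡ-≡ c c' 2 (trans (sym n≡2c) n≡2c')
... | refl = valuation-exclusive ec oc

evenValuation-double : ∀ {c} → EvenValuation c → ¬ EvenValuation (2 * c)
evenValuation-double {c} _ (odd k 2c≡1+2k) = 2*m≢1+2*n c k 2c≡1+2k
evenValuation-double {c} ec (double {c = c'} oc' 2c≡2c') with *-cancelˡ-≡ c c' 2 2c≡2c'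
... | refl = valuation-exclusive ec oc'

valuation-parity : ∀ n → 0 < n → EvenValuation n ⊎ OddValuation n
valuation-parity n = go n (<-wellFounded n)
  where
  go : ∀ n → Acc _<_ n → 0 < n → EvenValuation n ⊎ OddValuation n
  go n (acc rec) 0<n with parity n
  ... | k , inj₂ n≡1+2k = inj₁ (odd k n≡1+2k)
  ... | k , inj₁ refl with go k (rec (n<2*n 0<k)) 0<k
    where
    0<k : 0 < k
    0<k = n≢0⇒n>0 λ { refl → <-irrefl refl 0<n }
  ...   | inj₁ ek = inj₂ (double ek refl)
  ...   | inj₂ ok = inj₁ (double ok refl)

Occurs : ℕ → ℕ → Set
Occurs m a = m ≡ a ⊎ m ≡ 2 * a

occurs-evenValuation : ∀ {m} → 0 < m → ∃[ a ] (EvenValuation a × Occurs m a)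
occurs-evenValuation {m} 0<m with valuation-parity m 0<m
... | inj₁ em = m , em , inj₁ refl
... | inj₂ (double {c = c} ec m≡2c) = c , ec , inj₂ m≡2c

occurs-exclusive : ∀ {m a} → 0 < a → ¬ (m ≡ a × m ≡ 2 * a)
occurs-exclusive 0<a (refl , a≡2a) = <-irrefl a≡2a (n<2*n 0<a)

occurs-evenValuation-unique : ∀ {m a a'} → EvenValuation a → EvenValuation a' →
                              Occurs m a → Occurs m a' → a ≡ a'
occurs-evenValuation-unique _ _ (inj₁ m≡a) (inj₁ m≡a') = trans (sym m≡a) m≡a'
occurs-evenValuation-unique {a = a} {a'} _ _ (inj₂ m≡2a) (inj₂ m≡2a') =
  *-cancelˡ-≡ a a' 2 (trans (sym m≡2a) m≡2a')
occurs-evenValuation-unique ea ea' (inj₁ refl) (inj₂ refl) = ⊥-elim (evenValuation-double ea' ea)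
occurs-evenValuation-unique ea ea' (inj₂ refl) (inj₁ refl) = ⊥-elim (evenValuation-double ea ea')

move-swap : ∀ {x y x' y'} → Move x y x' y' → Move y x y' x'
move-swap (left x'<x)             = down x'<x
move-swap (down y'<y)             = left y'<y
move-swap (diag 1≤s s≤x s≤y)      = diag 1≤s s≤y s≤x
move-swap (bounceL x<y 0<t t<2x)  = bounceD x<y 0<t t<2x
move-swap (bounceD y<x 0<t t<2y)  = bounceL y<x 0<t t<2y

move-decreases : ∀ {x y x' y'} → Move x y x' y' → x' + y' < x + y
move-decreases {x} {y} (left x'<x) = +-monoˡ-< y x'<x
move-decreases {x} {y} (down y'<y) = +-monoʳ-< x y'<y
move-decreases {x} {y} (diag {s} 1≤s s≤x _) = +-mono-<-≤ (∸-monoʳ-< 1≤s s≤x) (m∸n≤m y s)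
move-decreases {x} {y} (bounceL {t} x<y _ t<2x) = begin-strict
  t + (y ∸ x)        <⟨ +-monoˡ-< (y ∸ x) t<2x ⟩
  2 * x + (y ∸ x)    ≡⟨ cong (_+ (y ∸ x)) (2*n≡n+n x) ⟩
  x + x + (y ∸ x)    ≡⟨ +-assoc x x (y ∸ x) ⟩
  x + (x + (y ∸ x))  ≡⟨ cong (x +_) (m+[n∸m]≡n (<⇒≤ x<y)) ⟩
  x + y              ∎
  where open ≤-Reasoning
move-decreases {x} {y} m@(bounceD {t} _ _ _) =
  subst₂ _<_ (+-comm t (x ∸ y)) (+-comm y x) (move-decreases (move-swap m))

MovesInto : (ℕ → ℕ → Set) → ℕ → ℕ → Set
MovesInto K x y = ∃₂ λ x' y' → Move x y x' y' × K x' y'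

module KernelCharacterisation
  (K : ℕ → ℕ → Set)
  (independent : ∀ {x y x' y'} → K x y → Move x y x' y' → ¬ K x' y')
  (absorbing : ∀ x y → K x y ⊎ MovesInto K x y)
  where

  private
    P⇔K×N⇔¬K : ∀ x y → Acc _<_ (x + y) → (IsP x y ⇔ K x y) × (IsN x y ⇔ (¬ K x y))
    P⇔K×N⇔¬K x y (acc rec) = mk⇔ P⇒K K⇒P , mk⇔ N⇒¬K ¬K⇒N
      where
      ih : ∀ {x' y'} → Move x y x' y' → (IsP x' y' ⇔ K x' y') × (IsN x' y' ⇔ (¬ K x' y'))
      ih m = P⇔K×N⇔¬K _ _ (rec (move-decreases m))

      K⇒P : K x y → IsP x y
      K⇒P k = p-pos λ m → from (proj₂ (ih m)) (independent k m)

      ¬K⇒N : ¬ K x y → IsN x y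
      ¬K⇒N ¬k with absorbing x y
      ... | inj₁ k = ⊥-elim (¬k k)
      ... | inj₂ (_ , _ , m , k') = n-pos m (from (proj₁ (ih m)) k')

      P⇒K : IsP x y → K x y
      P⇒K (p-pos next) with absorbing x y
      ... | inj₁ k = k
      ... | inj₂ (_ , _ , m , k') = ⊥-elim (to (proj₂ (ih m)) (next m) k')

      N⇒¬K : IsN x y → ¬ K x y
      N⇒¬K (n-pos m p) k = independent k m (to (proj₁ (ih m)) p)

  P⇔K : ∀ {x y} → IsP x y ⇔ K x y
  P⇔K {x} {y} = proj₁ (P⇔K×N⇔¬K x y (<-wellFounded (x + y)))

data Kernel (x y : ℕ) : Set where
  origin : x ≡ 0 → y ≡ 0 → Kernel x y
  below  : ∀ {a} → EvenValuation a → x ≡ a → y ≡ 2 * a → Kernel x y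
  beside : ∀ {a} → EvenValuation a → x ≡ 2 * a → y ≡ a → Kernel x y

kernel-swap : ∀ {x y} → Kernel x y → Kernel y x
kernel-swap (origin x≡0 y≡0)     = origin y≡0 x≡0
kernel-swap (below ea x≡a y≡2a)  = beside ea y≡2a x≡a
kernel-swap (beside ea x≡2a y≡a) = below ea y≡a x≡2a

kernel-positive : ∀ {x y} → Kernel x y → 0 < x → 0 < y
kernel-positive (origin refl _) ()
kernel-positive (below {a} _ refl refl) 0<a = ≤-trans 0<a (m≤n*m a 2)
kernel-positive (beside ea _ refl) _ = evenValuation-positive ea

kernel-origin : ∀ {y} → Kernel 0 y → y ≡ 0
kernel-origin {zero} _ = refl
kernel-origin {suc _} k = ⊥-elim (<-irrefl refl (kernel-positive (kernel-swap k) z<s))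

kernel-functional : ∀ {x y y'} → Kernel x y → Kernel x y' → y ≡ y'
kernel-functional (origin refl refl) k' = sym (kernel-origin k')
kernel-functional k (origin refl refl) = kernel-origin k
kernel-functional (below _ refl refl) (below _ refl refl) = refl
kernel-functional (below ea refl _) (beside eb refl _) = ⊥-elim (evenValuation-double eb ea)
kernel-functional (beside ea refl _) (below eb refl _) = ⊥-elim (evenValuation-double ea eb)
kernel-functional (beside {a} _ refl refl) (beside {b} _ 2a≡2b refl) = *-cancelˡ-≡ a b 2 2a≡2b

kernel-injective : ∀ {x x' y} → Kernel x y → Kernel x' y → x ≡ x'
kernel-injective k k' = kernel-functional (kernel-swap k) (kernel-swap k')

kernel-ordered : ∀ {x y} → Kernel x y → x ≤ y → y ≡ 2 * x
kernel-ordered (origin refl refl) _ = refl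
kernel-ordered (below _ refl refl) _ = refl
kernel-ordered (beside ea refl refl) 2a≤a = ⊥-elim (<⇒≱ (n<2*n (evenValuation-positive ea)) 2a≤a)

kernel-evenValuation : ∀ {x y} → Kernel x y → x ≤ y → ¬ (x ≡ 0 × y ≡ 0) → EvenValuation x
kernel-evenValuation (origin x≡0 y≡0) _ nonzero = ⊥-elim (nonzero (x≡0 , y≡0))
kernel-evenValuation (below ea refl _) _ _ = ea
kernel-evenValuation (beside ea refl refl) 2a≤a _ = ⊥-elim (<⇒≱ (n<2*n (evenValuation-positive ea)) 2a≤a)

kernel-no-diagonal-step : ∀ {x y s} → x ≤ y → 0 < s → s ≤ x →
                          Kernel x y → ¬ Kernel (x ∸ s) (y ∸ s)
kernel-no-diagonal-step {x} {y} {s} x≤y 0<s s≤x k k' = <-irrefl s≡2s (n<2*n 0<s)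
  where
  open ≡-Reasoning
  y≡2x : y ≡ 2 * x
  y≡2x = kernel-ordered k x≤y
  2x∸s≡2x∸2s : 2 * x ∸ s ≡ 2 * x ∸ 2 * s
  2x∸s≡2x∸2s = begin
    2 * x ∸ s        ≡⟨ cong (_∸ s) y≡2x ⟨
    y ∸ s            ≡⟨ kernel-ordered k' (∸-monoˡ-≤ s x≤y) ⟩
    2 * (x ∸ s)      ≡⟨ *-distribˡ-∸ 2 x s ⟩
    2 * x ∸ 2 * s    ∎
  s≡2s : s ≡ 2 * s
  s≡2s = ∸-cancelˡ-≡ (≤-trans s≤x (m≤n*m x 2)) (*-monoʳ-≤ 2 s≤x) 2x∸s≡2x∸2s

kernel-no-bounce-step : ∀ {x y t} → x < y → t < 2 * x → Kernel x y → ¬ Kernel t (y ∸ x)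
kernel-no-bounce-step {x} {y} {t} x<y t<2x k k' = <-irrefl (trans t≡y y≡2x) t<2x
  where
  y≡2x : y ≡ 2 * x
  y≡2x = kernel-ordered k (<⇒≤ x<y)
  y∸x≡x : y ∸ x ≡ x
  y∸x≡x = trans (cong (_∸ x) y≡2x) (2*n∸n≡n x)
  t≡y : t ≡ y
  t≡y = kernel-injective k' (subst (Kernel y) (sym y∸x≡x) (kernel-swap k))

kernel-independent : ∀ {x y x' y'} → Kernel x y → Move x y x' y' → ¬ Kernel x' y'
kernel-independent k (left x'<x) k' = <-irrefl (kernel-injective k' k) x'<x
kernel-independent k (down y'<y) k' = <-irrefl (kernel-functional k' k) y'<y
kernel-independent {x} {y} k (diag 0<s s≤x s≤y) k' with ≤-total x y
... | inj₁ x≤y = kernel-no-diagonal-step x≤y 0<s s≤x k k'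
... | inj₂ y≤x = kernel-no-diagonal-step y≤x 0<s s≤y (kernel-swap k) (kernel-swap k')
kernel-independent k (bounceL x<y _ t<2x) k' = kernel-no-bounce-step x<y t<2x k k'
kernel-independent k (bounceD y<x _ t<2y) k' =
  kernel-no-bounce-step y<x t<2y (kernel-swap k) (kernel-swap k')

kernel-partner : ∀ x → ∃[ z ] (Kernel x z × z ≤ 2 * x)
kernel-partner zero = 0 , origin refl refl , z≤n
kernel-partner x@(suc _) with valuation-parity x z<s
... | inj₁ ex = 2 * x , below ex refl refl , ≤-refl
... | inj₂ (double {c = c} ec x≡2c) =
  c , beside ec x≡2c refl , ≤-trans (m≤n*m c 2) (≤-trans (≤-reflexive (sym x≡2c)) (m≤n*m x 2))

kernel-absorbing-ordered : ∀ {x y} → x ≤ y → Kernel x y ⊎ MovesInto Kernel x y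
kernel-absorbing-ordered {x} {y} x≤y with 2 * x ≤? y | kernel-partner x
... | yes 2x≤y | z , kxz , z≤2x with m≤n⇒m<n∨m≡n (≤-trans z≤2x 2x≤y)
...   | inj₁ z<y  = inj₂ (x , z , down z<y , kxz)
...   | inj₂ refl = inj₁ kxz
kernel-absorbing-ordered {x} {y} x≤y | no 2x≰y | _ with m≤n⇒m<n∨m≡n x≤y
...   | inj₂ refl = inj₂ (_ , _ , diag 0<x ≤-refl ≤-refl , origin (n∸n≡0 x) (n∸n≡0 x))
  where
  0<x : 0 < x
  0<x = n≢0⇒n>0 λ { refl → 2x≰y z≤n }
...   | inj₁ x<y with kernel-partner (y ∸ x)
...     | t , kdt , t≤2d = inj₂ (t , y ∸ x , bounceL x<y 0<t t<2x , kernel-swap kdt)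
  where
  d<x : y ∸ x < x
  d<x = subst (y ∸ x <_) (2*n∸n≡n x) (∸-monoˡ-< (≰⇒> 2x≰y) x≤y)
  0<t : 0 < t
  0<t = kernel-positive kdt (m<n⇒0<n∸m x<y)
  t<2x : t < 2 * x
  t<2x = ≤-<-trans t≤2d (*-monoʳ-< 2 d<x)

kernel-absorbing : ∀ x y → Kernel x y ⊎ MovesInto Kernel x y
kernel-absorbing x y with ≤-total x y
... | inj₁ x≤y = kernel-absorbing-ordered x≤y
... | inj₂ y≤x with kernel-absorbing-ordered y≤x
...   | inj₁ k = inj₁ (kernel-swap k)
...   | inj₂ (x' , y' , m , k) = inj₂ (y' , x' , move-swap m , kernel-swap k)

open KernelCharacterisation Kernel kernel-independent kernel-absorbing

P-occurs-unique : ∀ {m a a' b'} → EvenValuation a → Occurs m a →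
                  IsP a' b' → ¬ (a' ≡ 0 × b' ≡ 0) → a' ≤ b' → (m ≡ a' ⊎ m ≡ b') →
                  a' ≡ a × b' ≡ 2 * a
P-occurs-unique ea m∈a isP nonzero a'≤b' m∈a'b'
  with kernel-evenValuation (to P⇔K isP) a'≤b' nonzero | kernel-ordered (to P⇔K isP) a'≤b'
... | ea' | refl with occurs-evenValuation-unique ea' ea m∈a'b' m∈a
...   | refl = refl , refl

theorem1 :
    (∀ a b → IsP a b → ¬ (a ≡ 0 × b ≡ 0) → a ≤ b → b ≡ 2 * a)
    × (∀ m → 0 < m →
         Σ ℕ λ a → Σ ℕ λ b →
           (IsP a b × ¬ (a ≡ 0 × b ≡ 0) × a ≤ b
             × (m ≡ a ⊎ m ≡ b) × ¬ (m ≡ a × m ≡ b))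
           × (∀ a' b' → IsP a' b' → ¬ (a' ≡ 0 × b' ≡ 0) → a' ≤ b'
                → (m ≡ a' ⊎ m ≡ b') → (a' ≡ a × b' ≡ b)))
theorem1 =
  (λ _ _ isP _ → kernel-ordered (to P⇔K isP)) ,
  λ m 0<m →
    let a , ea , m∈a = occurs-evenValuation 0<m
        0<a = evenValuation-positive ea
    in a , 2 * a ,
       ( from P⇔K (below ea refl refl)
       , (λ (a≡0 , _) → <-irrefl (sym a≡0) 0<a)
       , m≤n*m a 2
       , m∈a
       , occurs-exclusive 0<a )
       , λ _ _ → P-occurs-unique ea m∈a
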